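{- Let $G=(V,E)$ be a finite simple undirected graph with totally ordered vertex set $V$. Let $S'=\{(u,\mathrm{canRef}(u)) : u\in V,\ \mathrm{canRef}(u)\neq u,\ N(u)\subseteq N[\mathrm{canRef}(u)]\}$. Then every $(u,\rho)\in S'$ satisfies $N(u)\subseteq N[\rho]$, and $S\subseteq S'$.
   Context: For $u\in V$, $N(u)$ is the open neighbourhood, $N[u]=N(u)\cup\{u\}$, $\deg(u)=|N(u)|$. For $\rho\in V$: $N_1(\rho)=\{u\in N(\rho): N(u)\setminus N[\rho]\neq\emptyset\}$; $N_2(\rho)=\{u\in N(\rho)\setminus N_1(\rho): N(u)\cap N_1(\rho)\neq\emptyset\}$; $N_3(\rho)=N(\rho)\setminus N_1(\rho)\setminus N_2(\rho)$. Let $C=\{(u,\rho): \rho\in V,\ u\in N_3(\rho)\}$, $\mathrm{canRef}(u)=\arg\max_{v\in N[u]}(\deg(v),v)$ in lexicographic order (largest degree, ties broken by largest vertex), and $S=\{(u,\rho)\in C:\ \rho=\mathrm{canRef}(u)\}$. (The set $S'$ is the output of the paper's Algorithm 1.) -}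

module Defs where

open import Data.Nat using (ℕ; _<_; _≤_)
open import Data.Nat.Properties using (_<?_; _≟_)
open import Data.Bool using (Bool; true; false; if_then_else_)
open import Data.Fin using (Fin; toℕ)
open import Data.List using (List; foldr; filter; length; allFin)
open import Data.Product using (_×_; ∃)
open import Data.Sum using (_⊎_)
open import Relation.Nullary using (¬_; does)
open import Relation.Binary.PropositionalEquality using (_≡_; _≢_)
open import Data.Bool.Properties using (T?)

-- A finite simple undirected graph on the vertex set Fin n, totally
-- ordered by the usual order on Fin n (compare via toℕ).
record Graph (n : ℕ) : Set where
  field
    adj    : Fin n → Fin n → Bool
    sym    : ∀ u v → adj u v ≡ adj v u
    irrefl : ∀ u → adj u u ≡ false

module _ {n : ℕ} (G : Graph n) where
  open Graph G

  Adj : Fin n → Fin n → Set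
  Adj u v = adj u v ≡ true

  deg : Fin n → ℕ
  deg u = length (filter (λ v → T? (adj u v)) (allFin n))

  keyLt : Fin n → Fin n → Bool
  keyLt a b = does (deg a <? deg b)
    Data.Bool.∨ (does (deg a ≟ deg b) Data.Bool.∧ does (toℕ a <? toℕ b))

  -- canRef(u) = argmax over N[u] of (deg v, v), lexicographically.
  canRef : Fin n → Fin n
  canRef u = foldr step u (allFin n)
    where
      step : Fin n → Fin n → Fin n
      step v best = if adj u v Data.Bool.∧ keyLt best v then v else best

  _⊆N[_] : Fin n → Fin n → Set
  u ⊆N[ ρ ] = ∀ w → Adj u w → (w ≡ ρ ⊎ Adj ρ w)

  N₁ : Fin n → Fin n → Set
  N₁ ρ u = Adj ρ u × ∃ λ w → Adj u w × w ≢ ρ × ¬ Adj ρ w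

  N₂ : Fin n → Fin n → Set
  N₂ ρ u = Adj ρ u × ¬ N₁ ρ u × ∃ λ w → Adj u w × N₁ ρ w

  N₃ : Fin n → Fin n → Set
  N₃ ρ u = Adj ρ u × ¬ N₁ ρ u × ¬ N₂ ρ u

  InC : Fin n → Fin n → Set
  InC u ρ = N₃ ρ u

  InS : Fin n → Fin n → Set
  InS u ρ = InC u ρ × ρ ≡ canRef u

  InS' : Fin n → Fin n → Set
  InS' u ρ = ρ ≡ canRef u × canRef u ≢ u × u ⊆N[ canRef u ]

{-# OPTIONS --safe #-}
module Submission where

open import Defs
open import Data.Nat using (ℕ)
open import Data.Fin using (Fin)
open import Data.Fin.Properties using () renaming (_≟_ to _≟ᶠ_)
open import Data.Bool using (true)
open import Data.Bool.Properties using () renaming (_≟_ to _≟ᵇ_)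
open import Data.Product using (_×_; _,_)
open import Data.Sum using (inj₁; inj₂)
open import Relation.Nullary using (¬_; yes; no; contradiction)
open import Relation.Binary.PropositionalEquality using (_≢_; refl; sym; trans)

module _ {n : ℕ} (G : Graph n) where
  open Graph G using (adj; irrefl)

  Adj⇒≢ : ∀ {u v} → Adj G u v → u ≢ v
  Adj⇒≢ {u} uv refl with () ← trans (sym uv) (irrefl u)

  ¬N₁⇒⊆N[] : ∀ {ρ u} → Adj G ρ u → ¬ N₁ G ρ u → _⊆N[_] G u ρ
  ¬N₁⇒⊆N[] {ρ} ρu ¬N₁ w uw with w ≟ᶠ ρ | adj ρ w ≟ᵇ true
  ... | yes w≡ρ | _        = inj₁ w≡ρ
  ... | no _    | yes ρw   = inj₂ ρw
  ... | no w≢ρ  | no ¬ρw   = contradiction (ρu , w , uw , w≢ρ , ¬ρw) ¬N₁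

  InS'⇒⊆N[] : (u ρ : Fin n) → InS' G u ρ → _⊆N[_] G u ρ
  InS'⇒⊆N[] u ρ (refl , _ , u⊆N[ρ]) = u⊆N[ρ]

  InS⇒InS' : (u ρ : Fin n) → InS G u ρ → InS' G u ρ
  InS⇒InS' u ρ ((ρu , ¬N₁ , _) , refl) = refl , Adj⇒≢ ρu , ¬N₁⇒⊆N[] ρu ¬N₁

mainTheorem4 : (n : ℕ) (G : Graph n) →
    ((u ρ : Fin n) → InS' G u ρ → _⊆N[_] G u ρ)
    × ((u ρ : Fin n) → InS G u ρ → InS' G u ρ)
mainTheorem4 n G = InS'⇒⊆N[] G , InS⇒InS' G
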